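{- Let $\mathcal{S}=\langle\mathcal{X},\mathcal{Y},\alpha,\varphi\rangle$ be a constrained $\mathsf{LTL_f}$ specification and let $\mathsf{alive},\mathsf{end}$ be fresh variables. Then $\mathcal{S}$ is realizable iff the $\mathsf{LTL}$ specification $\mathcal{S}^\infty=\langle\mathcal{X},\mathcal{Y}\cup\{\mathsf{alive},\mathsf{end}\},\psi_{\alpha,\varphi}\rangle$ is realizable. Moreover, for every winning strategy $\sigma$ for $\mathcal{S}^\infty$, the function $\sigma'$ defined by $\sigma'(X_1\cdots X_n):=\sigma(X_1\cdots X_n)\setminus\{\mathsf{alive}\}$ is a winning strategy for $\mathcal{S}$.
   Context: Formulas over variables $\mathcal{P}$ are built from $\top,\bot,p,\neg,\wedge,\vee,\mathsf{X},\mathsf{U},\mathsf{R}$; $\mathsf{F}\psi:=\top\mathsf{U}\psi$, $\mathsf{G}\psi:=\bot\mathsf{R}\psi$, $\to,\leftrightarrow$ as usual. $\mathsf{LTL}$ is interpreted on infinite traces (infinite words over $2^{\mathcal{P}}$) in the usual way; $\mathsf{LTL_f}$ on finite traces $\pi$: $\pi\models_i\mathsf{X}\psi$ iff $|\pi|>i$ and $\pi\models_{i+1}\psi$, and $\mathsf{U},\mathsf{R}$ range only over positions $j\le|\pi|$. Translation: for an $\mathsf{LTL_f}$ formula written with $\top,\bot,p,\neg,\wedge,\mathsf{X},\mathsf{U}$ (other connectives eliminated by $\psi_1\vee\psi_2\equiv\neg(\neg\psi_1\wedge\neg\psi_2)$, $\psi_1\mathsf{R}\psi_2\equiv\neg(\neg\psi_1\mathsf{U}\neg\psi_2)$),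 define $\tau(p)=p$, $\tau(\top)=\top$, $\tau(\bot)=\bot$, $\tau(\neg\psi)=\neg\tau(\psi)$, $\tau(\psi_1\wedge\psi_2)=\tau(\psi_1)\wedge\tau(\psi_2)$, $\tau(\mathsf{X}\psi)=\mathsf{X}(\mathsf{alive}\wedge\tau(\psi))$, $\tau(\psi_1\mathsf{U}\psi_2)=\tau(\psi_1)\mathsf{U}(\mathsf{alive}\wedge\tau(\psi_2))$. Let $\varphi_{\mathsf{inf}}:=\tau(\varphi)\wedge\mathsf{alive}\wedge(\mathsf{alive}\,\mathsf{U}\,\mathsf{G}\neg\mathsf{alive})$, $\psi_{\mathsf{end}}:=\mathsf{G}(\mathsf{end}\leftrightarrow\mathsf{alive}\wedge\mathsf{X}\neg\mathsf{alive})\wedge\mathsf{G}(\mathsf{end}\rightarrow\mathsf{X}\mathsf{G}\neg\mathsf{end})$, and $\psi_{\alpha,\varphi}:=\psi_{\mathsf{end}}\wedge((\alpha\vee\mathsf{F}\,\mathsf{end})\rightarrow\varphi_{\mathsf{inf}})$. $\mathsf{LTL}$ specification $\langle\mathcal{X},\mathcal{Y}',\psi\rangle$: a strategy is any $\sigma:(2^{\mathcal{X}})^*\to2^{\mathcal{Y}'}$; it is winning if for every infinite $\mathbf{X}=X_1X_2\dots$ of subsets of $\mathcal{X}$, the infinite trace $(X_1\cup\sigma(X_1))(X_2\cup\sigma(X_1X_2))\cdots$ satisfies $\psi$ (here $\mathsf{end}$ is an ordinary variable). Realizable iff a winning strategy exists. Constrained $\mathsf{LTL_f}$ specification $\langle\mathcal{X},\mathcal{Y},\alpha,\varphi\rangle$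 ($\mathcal{X},\mathcal{Y}$ disjoint; $\alpha$ an $\mathsf{LTL}$ formula, $\varphi$ an $\mathsf{LTL_f}$ formula, both over $\mathcal{X}\cup\mathcal{Y}$): a strategy is $\sigma:(2^{\mathcal{X}})^*\to2^{\mathcal{Y}\cup\{\mathsf{end}\}}$ such that for every $\mathbf{X}$ there is at most one $n=n_{\sigma,\mathbf{X}}$ with $\mathsf{end}\in\sigma(X_1\cdots X_n)$ ($\infty$ if none); induced infinite trace $(X_1\cup\sigma(X_1))(X_2\cup\sigma(X_1X_2))\cdots$; if $n<\infty$ induced finite trace $(X_1\cup\sigma(X_1))\cdots(X_n\cup\sigma(X_1\cdots X_n))$ with $\mathsf{end}$ removed. Winning iff for every $\mathbf{X}$: either $n_{\sigma,\mathbf{X}}=\infty$ and the induced infinite trace falsifies $\alpha$, or $n_{\sigma,\mathbf{X}}<\infty$ and the induced finite trace satisfies $\varphi$. -}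

module Defs where

open import Data.Nat using (ℕ; zero; suc; _≤_; _<_)
open import Data.Bool using (Bool; true; false; T)
open import Data.List using (List; map; upTo)
open import Data.Sum using (_⊎_; inj₁; inj₂; [_,_])
open import Data.Product using (Σ; _×_; _,_)
open import Data.Unit using (⊤; tt)
open import Data.Empty using (⊥)
open import Relation.Nullary using (¬_)
open import Relation.Binary.PropositionalEquality using (_≡_)
open import Function.Bundles using (_⇔_)

data Form (A : Set) : Set where
  ⊤ᶠ ⊥ᶠ : Form A
  var   : A → Form A
  ¬ᶠ_   : Form A → Form A
  _∧ᶠ_  : Form A → Form A → Form A
  _∨ᶠ_  : Form A → Form A → Form A
  Xᶠ_   : Form A → Form A
  _Uᶠ_  : Form A → Form A → Form A
  _Rᶠ_  : Form A → Form A → Form A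

Fᶠ_ : ∀ {A} → Form A → Form A
Fᶠ ψ = ⊤ᶠ Uᶠ ψ

Gᶠ_ : ∀ {A} → Form A → Form A
Gᶠ ψ = ⊥ᶠ Rᶠ ψ

_⇒ᶠ_ : ∀ {A} → Form A → Form A → Form A
ψ₁ ⇒ᶠ ψ₂ = (¬ᶠ ψ₁) ∨ᶠ ψ₂

_⇔ᶠ_ : ∀ {A} → Form A → Form A → Form A
ψ₁ ⇔ᶠ ψ₂ = (ψ₁ ⇒ᶠ ψ₂) ∧ᶠ (ψ₂ ⇒ᶠ ψ₁)

rename : ∀ {A B} → (A → B) → Form A → Form B
rename f ⊤ᶠ = ⊤ᶠ
rename f ⊥ᶠ = ⊥ᶠ
rename f (var p) = var (f p)
rename f (¬ᶠ ψ) = ¬ᶠ rename f ψ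
rename f (ψ₁ ∧ᶠ ψ₂) = rename f ψ₁ ∧ᶠ rename f ψ₂
rename f (ψ₁ ∨ᶠ ψ₂) = rename f ψ₁ ∨ᶠ rename f ψ₂
rename f (Xᶠ ψ) = Xᶠ rename f ψ
rename f (ψ₁ Uᶠ ψ₂) = rename f ψ₁ Uᶠ rename f ψ₂
rename f (ψ₁ Rᶠ ψ₂) = rename f ψ₁ Rᶠ rename f ψ₂

-- Traces: position i (0-based; position i here is position i+1 in the
-- paper) carries a valuation A → Bool, i.e. a subset of A.

Letter : Set → Set
Letter A = A → Bool

Trace : Set → Set
Trace A = ℕ → Letter A

_⊨∞[_]_ : ∀ {A} → Trace A → ℕ → Form A → Set
π ⊨∞[ i ] ⊤ᶠ = ⊤
π ⊨∞[ i ] ⊥ᶠ = ⊥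
π ⊨∞[ i ] var p = T (π i p)
π ⊨∞[ i ] (¬ᶠ ψ) = ¬ (π ⊨∞[ i ] ψ)
π ⊨∞[ i ] (ψ₁ ∧ᶠ ψ₂) = (π ⊨∞[ i ] ψ₁) × (π ⊨∞[ i ] ψ₂)
π ⊨∞[ i ] (ψ₁ ∨ᶠ ψ₂) = (π ⊨∞[ i ] ψ₁) ⊎ (π ⊨∞[ i ] ψ₂)
π ⊨∞[ i ] (Xᶠ ψ) = π ⊨∞[ suc i ] ψ
π ⊨∞[ i ] (ψ₁ Uᶠ ψ₂) =
  Σ ℕ λ j → i ≤ j × (π ⊨∞[ j ] ψ₂) × (∀ k → i ≤ k → k < j → π ⊨∞[ k ] ψ₁)
π ⊨∞[ i ] (ψ₁ Rᶠ ψ₂) =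
  ∀ j → i ≤ j → (π ⊨∞[ j ] ψ₂) ⊎ (Σ ℕ λ k → i ≤ k × k < j × (π ⊨∞[ k ] ψ₁))

-- LTLf on the finite trace π(0) … π(n-1) of length n
_,_⊨f[_]_ : ∀ {A} → ℕ → Trace A → ℕ → Form A → Set
n , π ⊨f[ i ] ⊤ᶠ = ⊤
n , π ⊨f[ i ] ⊥ᶠ = ⊥
n , π ⊨f[ i ] var p = T (π i p)
n , π ⊨f[ i ] (¬ᶠ ψ) = ¬ (n , π ⊨f[ i ] ψ)
n , π ⊨f[ i ] (ψ₁ ∧ᶠ ψ₂) = (n , π ⊨f[ i ] ψ₁) × (n , π ⊨f[ i ] ψ₂)
n , π ⊨f[ i ] (ψ₁ ∨ᶠ ψ₂) = (n , π ⊨f[ i ] ψ₁) ⊎ (n , π ⊨f[ i ] ψ₂)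
n , π ⊨f[ i ] (Xᶠ ψ) = (suc i < n) × (n , π ⊨f[ suc i ] ψ)
n , π ⊨f[ i ] (ψ₁ Uᶠ ψ₂) =
  Σ ℕ λ j → i ≤ j × j < n × (n , π ⊨f[ j ] ψ₂)
           × (∀ k → i ≤ k → k < j → n , π ⊨f[ k ] ψ₁)
n , π ⊨f[ i ] (ψ₁ Rᶠ ψ₂) =
  ∀ j → i ≤ j → j < n →
    (n , π ⊨f[ j ] ψ₂) ⊎ (Σ ℕ λ k → i ≤ k × k < j × (n , π ⊨f[ k ] ψ₁))

-- The translation τ (parameterised by the formula 'alive').
-- ∨ and R are first eliminated as in the paper:
--   ψ₁ ∨ ψ₂ ≡ ¬(¬ψ₁ ∧ ¬ψ₂),  ψ₁ R ψ₂ ≡ ¬(¬ψ₁ U ¬ψ₂).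

τ : ∀ {A} → Form A → Form A → Form A
τ a ⊤ᶠ = ⊤ᶠ
τ a ⊥ᶠ = ⊥ᶠ
τ a (var p) = var p
τ a (¬ᶠ ψ) = ¬ᶠ τ a ψ
τ a (ψ₁ ∧ᶠ ψ₂) = τ a ψ₁ ∧ᶠ τ a ψ₂
τ a (ψ₁ ∨ᶠ ψ₂) = ¬ᶠ ((¬ᶠ τ a ψ₁) ∧ᶠ (¬ᶠ τ a ψ₂))
τ a (Xᶠ ψ) = Xᶠ (a ∧ᶠ τ a ψ)
τ a (ψ₁ Uᶠ ψ₂) = τ a ψ₁ Uᶠ (a ∧ᶠ τ a ψ₂)
τ a (ψ₁ Rᶠ ψ₂) = ¬ᶠ ((¬ᶠ τ a ψ₁) Uᶠ (a ∧ᶠ (¬ᶠ τ a ψ₂)))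

data Fresh : Set where
  alive end : Fresh

data End : Set where
  end : End

-- X₁ ⋯ Xₙ for an infinite input sequence xs (X₁ = xs 0)
prefix : ∀ {X : Set} → (ℕ → Letter X) → ℕ → List (Letter X)
prefix xs n = map xs (upTo n)

induced : ∀ {X Z : Set} → (List (Letter X) → Letter Z) → (ℕ → Letter X) → Trace (X ⊎ Z)
induced σ xs i = [ xs i , σ (prefix xs (suc i)) ]

WinningLTL : (X Y' : Set) → Form (X ⊎ Y') → (List (Letter X) → Letter Y') → Set
WinningLTL X Y' ψ σ = ∀ (xs : ℕ → Letter X) → induced σ xs ⊨∞[ 0 ] ψ

RealizableLTL : (X Y' : Set) → Form (X ⊎ Y') → Set
RealizableLTL X Y' ψ = Σ (List (Letter X) → Letter Y') (WinningLTL X Y' ψ)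

CStrategy : (X Y : Set) → Set
CStrategy X Y = List (Letter X) → Letter (Y ⊎ End)

-- end ∈ σ(X₁ ⋯ X_{k+1})  (i.e. n = k+1)
EndAt : ∀ {X Y} → CStrategy X Y → (ℕ → Letter X) → ℕ → Set
EndAt σ xs k = σ (prefix xs (suc k)) (inj₂ end) ≡ true

inducedC : ∀ {X Y} → CStrategy X Y → (ℕ → Letter X) → Trace (X ⊎ Y)
inducedC σ xs i = [ xs i , (λ y → σ (prefix xs (suc i)) (inj₁ y)) ]

IsCStrategy : ∀ {X Y} → CStrategy X Y → Set
IsCStrategy {X} σ = ∀ (xs : ℕ → Letter X) j k → EndAt σ xs j → EndAt σ xs k → j ≡ k

WinningC : (X Y : Set) → Form (X ⊎ Y) → Form (X ⊎ Y) → CStrategy X Y → Set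
WinningC X Y α φ σ =
  IsCStrategy σ ×
  (∀ (xs : ℕ → Letter X) →
     ((∀ k → ¬ EndAt σ xs k) × ¬ (inducedC σ xs ⊨∞[ 0 ] α))
     ⊎ (Σ ℕ λ k → EndAt σ xs k × (suc k , inducedC σ xs ⊨f[ 0 ] φ)))

RealizableC : (X Y : Set) → Form (X ⊎ Y) → Form (X ⊎ Y) → Set
RealizableC X Y α φ = Σ (CStrategy X Y) (WinningC X Y α φ)

emb : ∀ {X Y : Set} → X ⊎ Y → X ⊎ (Y ⊎ Fresh)
emb (inj₁ x) = inj₁ x
emb (inj₂ y) = inj₂ (inj₁ y)

aliveᶠ endᶠ : ∀ {X Y : Set} → Form (X ⊎ (Y ⊎ Fresh))
aliveᶠ = var (inj₂ (inj₂ alive))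
endᶠ = var (inj₂ (inj₂ end))

φ-inf : ∀ {X Y : Set} → Form (X ⊎ Y) → Form (X ⊎ (Y ⊎ Fresh))
φ-inf φ = τ aliveᶠ (rename emb φ) ∧ᶠ (aliveᶠ ∧ᶠ (aliveᶠ Uᶠ (Gᶠ (¬ᶠ aliveᶠ))))

ψ-end : ∀ {X Y : Set} → Form (X ⊎ (Y ⊎ Fresh))
ψ-end = (Gᶠ (endᶠ ⇔ᶠ (aliveᶠ ∧ᶠ (Xᶠ (¬ᶠ aliveᶠ)))))
        ∧ᶠ (Gᶠ (endᶠ ⇒ᶠ (Xᶠ (Gᶠ (¬ᶠ endᶠ)))))

ψ-αφ : ∀ {X Y : Set} → Form (X ⊎ Y) → Form (X ⊎ Y) → Form (X ⊎ (Y ⊎ Fresh))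
ψ-αφ α φ = ψ-end ∧ᶠ ((rename emb α ∨ᶠ (Fᶠ endᶠ)) ⇒ᶠ φ-inf φ)

dropAlive : ∀ {Y : Set} → Letter (Y ⊎ Fresh) → Letter (Y ⊎ End)
dropAlive s (inj₁ y) = s (inj₁ y)
dropAlive s (inj₂ end) = s (inj₂ end)

module Submission where

-- The proof works trace by trace.  On an infinite trace π with the fresh
-- atoms alive and end, the conjuncts of ψ_{α,φ} have a simple meaning:
--   * ψ_end says that end marks the last alive position and occurs at most
--     once (ψ-end-semantics);
--   * alive ∧ (alive U G ¬alive) says that alive holds exactly on an
--     initial segment [0, k] (lifespan-semantics);
--   * on such a trace, τ(φ) holds at 0 iff φ holds on the finite trace of
--     length k+1 (τ-correct, by induction on φ; classical logic is needed
--     because τ eliminates ∨ and R through their De Morgan duals).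
-- Together these show that a trace satisfies ψ_{α,φ} iff its end-marker is
-- unique and it meets the winning condition of the constrained specification
-- (ψ-αφ-sound, and ψ-αφ-complete for traces where alive means "no end
-- so far").  Forgetting alive thus turns a winning LTL strategy into a winning
-- constrained one (dropAlive-winning); conversely, a constrained strategy
-- that additionally outputs "no end so far" is a winning LTL strategy
-- (withAlive-winning).

open import Defs
open import Level using (0ℓ)
open import Axiom.ExcludedMiddle using (ExcludedMiddle)
open import Data.Nat using (ℕ; zero; suc; _≤_; _<_; z≤n; s≤s)
open import Data.Nat.Properties
  using (≤-refl; <-trans; ≰⇒>; <⇒≱; <-irrefl; <-≤-trans; <-cmp; ≤-pred; m<1+n⇒m<n∨m≡n)
open import Data.Bool using (Bool; true; false; T; T?; not; _∧_)
open import Data.Bool.Properties using (T-≡)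
open import Data.List using (List; []; _∷_; applyUpTo)
open import Data.List.Properties using (map-upTo)
open import Data.Product using (Σ; _×_; _,_; proj₁; proj₂)
open import Data.Product.Function.NonDependent.Propositional using (_×-⇔_)
open import Data.Sum using (_⊎_; inj₁; inj₂)
open import Data.Sum.Function.Propositional using (_⊎-⇔_)
open import Data.Unit using (tt)
open import Data.Empty using (⊥; ⊥-elim)
open import Relation.Nullary using (¬_; Dec; yes; no)
open import Relation.Binary.PropositionalEquality using (_≡_; refl; sym; cong; subst)
open import Relation.Binary.Definitions using (tri<; tri≈; tri>)
open import Function.Bundles using (_⇔_; mk⇔; Equivalence)
open import Function.Construct.Identity using (⇔-id)
open import Function.Construct.Symmetry using (⇔-sym)
open import Function.Construct.Composition using (_⇔-∘_)
open import Function.Related.TypeIsomorphisms using (¬-cong-⇔)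

open Equivalence using (to; from)

T-cong : ∀ {b c : Bool} → b ≡ c → T b ⇔ T c
T-cong eq = mk⇔ (subst T eq) (subst T (sym eq))

⊎⇔¬¬× : ExcludedMiddle 0ℓ → {A B : Set} → (A ⊎ B) ⇔ (¬ (¬ A × ¬ B))
⊎⇔¬¬× em {A} {B} = mk⇔ (λ { (inj₁ a) (¬a , _) → ¬a a ; (inj₂ b) (_ , ¬b) → ¬b b }) classical
  where
  classical : ¬ (¬ A × ¬ B) → A ⊎ B
  classical ¬¬ with em {A} | em {B}
  ... | yes a | _     = inj₁ a
  ... | no ¬a | yes b = inj₂ b
  ... | no ¬a | no ¬b = ⊥-elim (¬¬ (¬a , ¬b))

Unique : (ℕ → Set) → Set
Unique E = ∀ j k → E j → E k → j ≡ k

NoneBefore : (ℕ → Set) → ℕ → Set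
NoneBefore E i = ∀ j → j < i → ¬ E j

Unique-cong : ∀ {E E' : ℕ → Set} → (∀ j → E j ⇔ E' j) → Unique E ⇔ Unique E'
Unique-cong E⇔E' = mk⇔ (λ u j k e e' → u j k (from (E⇔E' j) e) (from (E⇔E' k) e'))
                       (λ u j k e e' → u j k (to (E⇔E' j) e) (to (E⇔E' k) e'))

NoneBefore-cong : ∀ {E E' : ℕ → Set} → (∀ j → E j ⇔ E' j) → ∀ i → NoneBefore E i ⇔ NoneBefore E' i
NoneBefore-cong E⇔E' i = mk⇔ (λ nb j j<i e' → nb j j<i (from (E⇔E' j) e'))
                             (λ nb j j<i e → nb j j<i (to (E⇔E' j) e))

unique⇔no-later : ∀ {E : ℕ → Set} → Unique E ⇔ (∀ j → E j → ∀ k → j < k → ¬ E k)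
unique⇔no-later {E} = mk⇔ (λ u j e k j<k e' → <-irrefl (u j k e e') j<k) by-trichotomy
  where
  by-trichotomy : (∀ j → E j → ∀ k → j < k → ¬ E k) → Unique E
  by-trichotomy later j k e e' with <-cmp j k
  ... | tri< j<k _ _ = ⊥-elim (later j e k j<k e')
  ... | tri≈ _ j≡k _ = j≡k
  ... | tri> _ _ k<j = ⊥-elim (later k e' j k<j e)

unique-occurrence : ∀ {E : ℕ → Set} → (∀ j → Dec (E j)) → Unique E →
  ∀ j → E j ⇔ (NoneBefore E j × ¬ NoneBefore E (suc j))
unique-occurrence {E} E? u j = mk⇔ occurs first
  where
  occurs : E j → NoneBefore E j × ¬ NoneBefore E (suc j)
  occurs e = (λ j' j'<j e' → <-irrefl (u j' j e' e) j'<j) , (λ nb → nb j ≤-refl e)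
  first : NoneBefore E j × ¬ NoneBefore E (suc j) → E j
  first (nb , ¬nb') with E? j
  ... | yes e = e
  ... | no ¬e = ⊥-elim (¬nb' λ j' j'<1+j → case (m<1+n⇒m<n∨m≡n j'<1+j))
    where
    case : ∀ {j'} → j' < j ⊎ j' ≡ j → ¬ E j'
    case (inj₁ j'<j) = nb _ j'<j
    case (inj₂ refl) = ¬e

noneBefore-unique : ∀ {E : ℕ → Set} {k} → Unique E → E k → ∀ i → NoneBefore E i ⇔ i < suc k
noneBefore-unique {k = k} u e i =
  mk⇔ (λ nb → ≰⇒> λ k<i → nb k k<i e)
      (λ i<1+k j j<i e' → <-irrefl (u j k e' e) (<-≤-trans j<i (≤-pred i<1+k)))

Agree : ∀ {A B : Set} → (A → B) → Trace B → Trace A → Set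
Agree f π ρ = ∀ i x → π i (f x) ≡ ρ i x

module _ {A B : Set} {f : A → B} {π : Trace B} {ρ : Trace A} (agree : Agree f π ρ) where

  rename-correct : ∀ ψ i → (π ⊨∞[ i ] rename f ψ) ⇔ (ρ ⊨∞[ i ] ψ)
  rename-correct ⊤ᶠ i = ⇔-id _
  rename-correct ⊥ᶠ i = ⇔-id _
  rename-correct (var x) i = T-cong (agree i x)
  rename-correct (¬ᶠ ψ) i = ¬-cong-⇔ (rename-correct ψ i)
  rename-correct (ψ₁ ∧ᶠ ψ₂) i = rename-correct ψ₁ i ×-⇔ rename-correct ψ₂ i
  rename-correct (ψ₁ ∨ᶠ ψ₂) i = rename-correct ψ₁ i ⊎-⇔ rename-correct ψ₂ i
  rename-correct (Xᶠ ψ) i = rename-correct ψ (suc i)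
  rename-correct (ψ₁ Uᶠ ψ₂) i = mk⇔
    (λ (j , i≤j , h₂ , h₁) → j , i≤j , to (rename-correct ψ₂ j) h₂ ,
                              λ k i≤k k<j → to (rename-correct ψ₁ k) (h₁ k i≤k k<j))
    (λ (j , i≤j , h₂ , h₁) → j , i≤j , from (rename-correct ψ₂ j) h₂ ,
                              λ k i≤k k<j → from (rename-correct ψ₁ k) (h₁ k i≤k k<j))
  rename-correct (ψ₁ Rᶠ ψ₂) i =
    mk⇔ (λ r j i≤j → to (at j) (r j i≤j)) (λ r j i≤j → from (at j) (r j i≤j))
    where
    earlier : ∀ j → (Σ ℕ λ k → i ≤ k × k < j × (π ⊨∞[ k ] rename f ψ₁))
                  ⇔ (Σ ℕ λ k → i ≤ k × k < j × (ρ ⊨∞[ k ] ψ₁))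
    earlier j = mk⇔ (λ (k , i≤k , k<j , h) → k , i≤k , k<j , to (rename-correct ψ₁ k) h)
                    (λ (k , i≤k , k<j , h) → k , i≤k , k<j , from (rename-correct ψ₁ k) h)
    at : ∀ j → ((π ⊨∞[ j ] rename f ψ₂) ⊎ (Σ ℕ λ k → i ≤ k × k < j × (π ⊨∞[ k ] rename f ψ₁)))
             ⇔ ((ρ ⊨∞[ j ] ψ₂) ⊎ (Σ ℕ λ k → i ≤ k × k < j × (ρ ⊨∞[ k ] ψ₁)))
    at j = rename-correct ψ₂ j ⊎-⇔ earlier j

release-dual : ExcludedMiddle 0ℓ → ∀ {A : Set} {n : ℕ} {ρ : Trace A} (ψ₁ ψ₂ : Form A) i →
  (n , ρ ⊨f[ i ] (ψ₁ Rᶠ ψ₂)) ⇔ (¬ (n , ρ ⊨f[ i ] ((¬ᶠ ψ₁) Uᶠ (¬ᶠ ψ₂))))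
release-dual em {n = n} {ρ} ψ₁ ψ₂ i = mk⇔ refute classical
  where
  refute : n , ρ ⊨f[ i ] (ψ₁ Rᶠ ψ₂) → ¬ (n , ρ ⊨f[ i ] ((¬ᶠ ψ₁) Uᶠ (¬ᶠ ψ₂)))
  refute r (j , i≤j , j<n , ¬h₂ , ¬h₁) with r j i≤j j<n
  ... | inj₁ h₂ = ¬h₂ h₂
  ... | inj₂ (k , i≤k , k<j , h₁) = ¬h₁ k i≤k k<j h₁
  classical : ¬ (n , ρ ⊨f[ i ] ((¬ᶠ ψ₁) Uᶠ (¬ᶠ ψ₂))) → n , ρ ⊨f[ i ] (ψ₁ Rᶠ ψ₂)
  classical ¬u j i≤j j<n
    with em {n , ρ ⊨f[ j ] ψ₂} | em {Σ ℕ λ k → i ≤ k × k < j × (n , ρ ⊨f[ k ] ψ₁)}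
  ... | yes h₂ | _      = inj₁ h₂
  ... | no ¬h₂ | yes h₁ = inj₂ h₁
  ... | no ¬h₂ | no ¬h₁ =
    ⊥-elim (¬u (j , i≤j , j<n , ¬h₂ , λ k i≤k k<j h → ¬h₁ (k , i≤k , k<j , h)))

module _ (em : ExcludedMiddle 0ℓ) {A B : Set} {f : A → B} {π : Trace B} {ρ : Trace A}
         (agree : Agree f π ρ) {a : Form B} {n : ℕ} (a-below : ∀ i → (π ⊨∞[ i ] a) ⇔ (i < n)) where

  τ-until : ∀ (θ₁ θ₂ : Form B) (χ₁ χ₂ : Form A) →
    (∀ k → k < n → (π ⊨∞[ k ] θ₁) ⇔ (n , ρ ⊨f[ k ] χ₁)) →
    (∀ k → k < n → (π ⊨∞[ k ] θ₂) ⇔ (n , ρ ⊨f[ k ] χ₂)) →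
    ∀ i → (π ⊨∞[ i ] (θ₁ Uᶠ (a ∧ᶠ θ₂))) ⇔ (n , ρ ⊨f[ i ] (χ₁ Uᶠ χ₂))
  τ-until θ₁ θ₂ χ₁ χ₂ θ₁⇔χ₁ θ₂⇔χ₂ i = mk⇔
    (λ (j , i≤j , (al , h₂) , h₁) → let j<n = to (a-below j) al in
       j , i≤j , j<n , to (θ₂⇔χ₂ j j<n) h₂ ,
       λ k i≤k k<j → to (θ₁⇔χ₁ k (<-trans k<j j<n)) (h₁ k i≤k k<j))
    (λ (j , i≤j , j<n , h₂ , h₁) →
       j , i≤j , (from (a-below j) j<n , from (θ₂⇔χ₂ j j<n) h₂) ,
       λ k i≤k k<j → from (θ₁⇔χ₁ k (<-trans k<j j<n)) (h₁ k i≤k k<j))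

  τ-correct : ∀ φ i → i < n → (π ⊨∞[ i ] τ a (rename f φ)) ⇔ (n , ρ ⊨f[ i ] φ)
  τ-correct ⊤ᶠ i _ = ⇔-id _
  τ-correct ⊥ᶠ i _ = ⇔-id _
  τ-correct (var x) i _ = T-cong (agree i x)
  τ-correct (¬ᶠ φ) i i<n = ¬-cong-⇔ (τ-correct φ i i<n)
  τ-correct (φ₁ ∧ᶠ φ₂) i i<n = τ-correct φ₁ i i<n ×-⇔ τ-correct φ₂ i i<n
  τ-correct (φ₁ ∨ᶠ φ₂) i i<n =
    ⇔-sym (⊎⇔¬¬× em) ⇔-∘ ¬-cong-⇔ (¬-cong-⇔ (τ-correct φ₁ i i<n) ×-⇔ ¬-cong-⇔ (τ-correct φ₂ i i<n))
  τ-correct (Xᶠ φ) i _ = mk⇔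
    (λ (al , h) → let i+1<n = to (a-below (suc i)) al in i+1<n , to (τ-correct φ (suc i) i+1<n) h)
    (λ (i+1<n , h) → from (a-below (suc i)) i+1<n , from (τ-correct φ (suc i) i+1<n) h)
  τ-correct (φ₁ Uᶠ φ₂) i _ =
    τ-until (τ a (rename f φ₁)) (τ a (rename f φ₂)) φ₁ φ₂ (τ-correct φ₁) (τ-correct φ₂) i
  τ-correct (φ₁ Rᶠ φ₂) i _ =
    ⇔-sym (release-dual em φ₁ φ₂ i) ⇔-∘
    ¬-cong-⇔ (τ-until (¬ᶠ τ a (rename f φ₁)) (¬ᶠ τ a (rename f φ₂)) (¬ᶠ φ₁) (¬ᶠ φ₂)
                      (λ k k<n → ¬-cong-⇔ (τ-correct φ₁ k k<n))
                      (λ k k<n → ¬-cong-⇔ (τ-correct φ₂ k k<n)) i)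

module Connectives {A : Set} (π : Trace A) where

  G-semantics : ∀ (ψ : Form A) {i} → (π ⊨∞[ i ] (Gᶠ ψ)) ⇔ (∀ j → i ≤ j → π ⊨∞[ j ] ψ)
  G-semantics ψ {i} = mk⇔ (λ g j i≤j → now (g j i≤j)) (λ h j i≤j → inj₁ (h j i≤j))
    where
    -- the release alternative would need ⊥ to hold somewhere
    now : ∀ {j} → (π ⊨∞[ j ] ψ) ⊎ (Σ ℕ λ k → i ≤ k × k < j × ⊥) → π ⊨∞[ j ] ψ
    now (inj₁ h) = h
    now (inj₂ (_ , _ , _ , ()))

  F-semantics : ∀ (ψ : Form A) {i} → (π ⊨∞[ i ] (Fᶠ ψ)) ⇔ (Σ ℕ λ j → i ≤ j × (π ⊨∞[ j ] ψ))
  F-semantics ψ = mk⇔ (λ (j , i≤j , h , _) → j , i≤j , h)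
                      (λ (j , i≤j , h) → j , i≤j , h , λ _ _ _ → tt)

module ClassicalConnectives (em : ExcludedMiddle 0ℓ) {A : Set} (π : Trace A) where

  ⇒-semantics : ∀ (ψ₁ ψ₂ : Form A) {i} → (π ⊨∞[ i ] (ψ₁ ⇒ᶠ ψ₂)) ⇔ (π ⊨∞[ i ] ψ₁ → π ⊨∞[ i ] ψ₂)
  ⇒-semantics ψ₁ ψ₂ {i} = mk⇔ (λ { (inj₁ ¬h₁) h₁ → ⊥-elim (¬h₁ h₁) ; (inj₂ h₂) _ → h₂ }) classical
    where
    classical : (π ⊨∞[ i ] ψ₁ → π ⊨∞[ i ] ψ₂) → π ⊨∞[ i ] (ψ₁ ⇒ᶠ ψ₂)
    classical imp with em {π ⊨∞[ i ] ψ₁}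
    ... | yes h₁ = inj₂ (imp h₁)
    ... | no ¬h₁ = inj₁ ¬h₁

  ⇔-semantics : ∀ (ψ₁ ψ₂ : Form A) {i} → (π ⊨∞[ i ] (ψ₁ ⇔ᶠ ψ₂)) ⇔ ((π ⊨∞[ i ] ψ₁) ⇔ (π ⊨∞[ i ] ψ₂))
  ⇔-semantics ψ₁ ψ₂ =
    mk⇔ (λ (h , h') → mk⇔ (to (⇒-semantics ψ₁ ψ₂) h) (to (⇒-semantics ψ₂ ψ₁) h'))
        (λ e → from (⇒-semantics ψ₁ ψ₂) (to e) , from (⇒-semantics ψ₂ ψ₁) (from e))

module _ {X Y : Set} (π : Trace (X ⊎ (Y ⊎ Fresh))) where

  Alive Ends : ℕ → Set
  Alive i = π ⊨∞[ i ] aliveᶠ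
  Ends i = π ⊨∞[ i ] endᶠ

  EndMarksLastAlive : Set
  EndMarksLastAlive = ∀ j → Ends j ⇔ (Alive j × ¬ Alive (suc j))

  AliveBelow : ℕ → Set
  AliveBelow n = ∀ i → Alive i ⇔ (i < n)

  AliveUntilEnd : Set
  AliveUntilEnd = ∀ i → Alive i ⇔ NoneBefore Ends i

module _ (em : ExcludedMiddle 0ℓ) {X Y : Set} {π : Trace (X ⊎ (Y ⊎ Fresh))} where

  ψ-end-semantics : (π ⊨∞[ 0 ] ψ-end) ⇔ (EndMarksLastAlive π × Unique (Ends π))
  ψ-end-semantics = marks ×-⇔ (⇔-sym unique⇔no-later ⇔-∘ no-later)
    where
    open Connectives π
    open ClassicalConnectives em π
    last-alive never-again marker once : Form (X ⊎ (Y ⊎ Fresh))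
    last-alive = aliveᶠ ∧ᶠ (Xᶠ (¬ᶠ aliveᶠ))
    never-again = Xᶠ (Gᶠ (¬ᶠ endᶠ))
    marker = endᶠ ⇔ᶠ last-alive
    once = endᶠ ⇒ᶠ never-again
    marks : (π ⊨∞[ 0 ] (Gᶠ marker)) ⇔ EndMarksLastAlive π
    marks = mk⇔ (λ g j → to (⇔-semantics endᶠ last-alive) (to (G-semantics marker) g j z≤n))
                (λ m → from (G-semantics marker) λ j _ → from (⇔-semantics endᶠ last-alive) (m j))
    no-later : (π ⊨∞[ 0 ] (Gᶠ once)) ⇔ (∀ j → Ends π j → ∀ k → j < k → ¬ Ends π k)
    no-later = mk⇔
      (λ g j e → to (G-semantics (¬ᶠ endᶠ))
                    (to (⇒-semantics endᶠ never-again) (to (G-semantics once) g j z≤n) e))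
      (λ later → from (G-semantics once) λ j _ →
                   from (⇒-semantics endᶠ never-again) λ e → from (G-semantics (¬ᶠ endᶠ)) (later j e))

lifespan-semantics : ∀ {X Y : Set} {π : Trace (X ⊎ (Y ⊎ Fresh))} →
  (π ⊨∞[ 0 ] (aliveᶠ ∧ᶠ (aliveᶠ Uᶠ (Gᶠ (¬ᶠ aliveᶠ))))) ⇔ (Σ ℕ λ k → AliveBelow π (suc k))
lifespan-semantics {π = π} = mk⇔ lifetime
  (λ (k , below) → from (below 0) (s≤s z≤n) , suc k , z≤n ,
     from (G-semantics (¬ᶠ aliveᶠ)) (λ m k<m al → <⇒≱ (to (below m) al) k<m) ,
     λ m _ m<1+k → from (below m) m<1+k)
  where
  open Connectives π
  exactly-below : ∀ J → (∀ m → J ≤ m → ¬ Alive π m) → (∀ m → m < J → Alive π m) → AliveBelow π J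
  exactly-below J dead live m = mk⇔ (λ al → ≰⇒> λ J≤m → dead m J≤m al) (live m)
  lifetime : π ⊨∞[ 0 ] (aliveᶠ ∧ᶠ (aliveᶠ Uᶠ (Gᶠ (¬ᶠ aliveᶠ)))) → Σ ℕ λ k → AliveBelow π (suc k)
  lifetime (alive₀ , zero , _ , g , _) = ⊥-elim (to (G-semantics (¬ᶠ aliveᶠ)) g 0 z≤n alive₀)
  lifetime (_ , suc k , _ , g , before) =
    k , exactly-below (suc k) (to (G-semantics (¬ᶠ aliveᶠ)) g) (λ m → before m z≤n)

ends-at-last-alive : ∀ {X Y : Set} {π : Trace (X ⊎ (Y ⊎ Fresh))} {k} →
  EndMarksLastAlive π → AliveBelow π (suc k) → Ends π k
ends-at-last-alive {k = k} marks below =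
  from (marks k) (from (below k) ≤-refl , λ alive-after → <-irrefl refl (to (below (suc k)) alive-after))

Verdict : ∀ {X Y : Set} → Form (X ⊎ Y) → Form (X ⊎ Y) → (ℕ → Set) → Trace (X ⊎ Y) → Set
Verdict α φ E ρ = ((∀ k → ¬ E k) × ¬ (ρ ⊨∞[ 0 ] α)) ⊎ (Σ ℕ λ k → E k × (suc k , ρ ⊨f[ 0 ] φ))

Verdict-cong : ∀ {X Y : Set} (α φ : Form (X ⊎ Y)) {ρ : Trace (X ⊎ Y)} {E E' : ℕ → Set} →
  (∀ j → E j ⇔ E' j) → Verdict α φ E ρ ⇔ Verdict α φ E' ρ
Verdict-cong α φ {ρ} E⇔E' =
  mk⇔ (move (λ j → to (E⇔E' j)) (λ j → from (E⇔E' j)))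
      (move (λ j → from (E⇔E' j)) (λ j → to (E⇔E' j)))
  where
  move : ∀ {E₁ E₂ : ℕ → Set} → (∀ j → E₁ j → E₂ j) → (∀ j → E₂ j → E₁ j) →
         Verdict α φ E₁ ρ → Verdict α φ E₂ ρ
  move _ back (inj₁ (never , ¬α)) = inj₁ ((λ k e → never k (back k e)) , ¬α)
  move forth _ (inj₂ (k , e , h)) = inj₂ (k , forth k e , h)

module _ (em : ExcludedMiddle 0ℓ) {X Y : Set} (α φ : Form (X ⊎ Y))
         {π : Trace (X ⊎ (Y ⊎ Fresh))} {ρ : Trace (X ⊎ Y)} (agree : Agree emb π ρ) where

  open Connectives π

  φ-inf-semantics : (π ⊨∞[ 0 ] φ-inf φ) ⇔ (Σ ℕ λ k → AliveBelow π (suc k) × (suc k , ρ ⊨f[ 0 ] φ))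
  φ-inf-semantics = mk⇔
    (λ (t , lifespan) → let (k , below) = to (lifespan-semantics {π = π}) lifespan in
                         k , below , to (translation below) t)
    (λ (k , below , h) → from (translation below) h , from (lifespan-semantics {π = π}) (k , below))
    where
    translation : ∀ {k} → AliveBelow π (suc k) →
                  (π ⊨∞[ 0 ] τ aliveᶠ (rename emb φ)) ⇔ (suc k , ρ ⊨f[ 0 ] φ)
    translation below = τ-correct em agree {a = aliveᶠ} below φ 0 (s≤s z≤n)

  ψ-αφ-sound : π ⊨∞[ 0 ] ψ-αφ α φ → Unique (Ends π) × Verdict α φ (Ends π) ρ
  ψ-αφ-sound (end-ok , inj₁ ¬trigger) =
    proj₂ (to (ψ-end-semantics em {π = π}) end-ok) , inj₁ (never , ¬α)
    where
    never : ∀ k → ¬ Ends π k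
    never k e = ¬trigger (inj₂ (from (F-semantics endᶠ) (k , z≤n , e)))
    ¬α : ¬ (ρ ⊨∞[ 0 ] α)
    ¬α h = ¬trigger (inj₁ (from (rename-correct agree α 0) h))
  ψ-αφ-sound (end-ok , inj₂ inf) =
    let (marks , unique) = to (ψ-end-semantics em {π = π}) end-ok
        (k , below , h) = to φ-inf-semantics inf
    in unique , inj₂ (k , ends-at-last-alive {π = π} marks below , h)

  ψ-αφ-complete : AliveUntilEnd π → Unique (Ends π) → Verdict α φ (Ends π) ρ → π ⊨∞[ 0 ] ψ-αφ α φ
  ψ-αφ-complete alive-until unique verdict =
    from (ψ-end-semantics em {π = π}) (marks , unique) , body verdict
    where
    marks : EndMarksLastAlive π
    marks j = ⇔-sym (alive-until j ×-⇔ ¬-cong-⇔ (alive-until (suc j)))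
              ⇔-∘ unique-occurrence (λ j → T? (π j (inj₂ (inj₂ end)))) unique j
    body : Verdict α φ (Ends π) ρ → π ⊨∞[ 0 ] ((rename emb α ∨ᶠ (Fᶠ endᶠ)) ⇒ᶠ φ-inf φ)
    body (inj₁ (never , ¬α)) = inj₁ λ
      { (inj₁ h) → ¬α (to (rename-correct agree α 0) h)
      ; (inj₂ f) → let (k , _ , e) = to (F-semantics endᶠ) f in never k e }
    body (inj₂ (k , e , h)) = inj₂ (from φ-inf-semantics (k , below , h))
      where
      below : AliveBelow π (suc k)
      below i = noneBefore-unique unique e i ⇔-∘ alive-until i

Forgets : ∀ {X Y : Set} → (List (Letter X) → Letter (Y ⊎ Fresh)) → CStrategy X Y → Set
Forgets σ∞ σ = ∀ w v → dropAlive (σ∞ w) v ≡ σ w v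

module _ {X Y : Set} {σ∞ : List (Letter X) → Letter (Y ⊎ Fresh)} {σ : CStrategy X Y}
         (forgets : Forgets σ∞ σ) (xs : ℕ → Letter X) where

  forget-agree : Agree emb (induced σ∞ xs) (inducedC σ xs)
  forget-agree i (inj₁ x) = refl
  forget-agree i (inj₂ y) = forgets (prefix xs (suc i)) (inj₁ y)

  forget-ends : ∀ j → Ends (induced σ∞ xs) j ⇔ EndAt σ xs j
  forget-ends j = T-≡ ⇔-∘ T-cong (forgets (prefix xs (suc j)) (inj₂ end))

dropAlive-winning : ExcludedMiddle 0ℓ →
  ∀ {X Y : Set} (α φ : Form (X ⊎ Y)) (σ : List (Letter X) → Letter (Y ⊎ Fresh)) →
  WinningLTL X (Y ⊎ Fresh) (ψ-αφ α φ) σ → WinningC X Y α φ (λ w → dropAlive (σ w))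
dropAlive-winning em α φ σ win =
  (λ xs → to (Unique-cong (forget-ends forgets xs)) (proj₁ (sound xs))) ,
  (λ xs → to (Verdict-cong α φ (forget-ends forgets xs)) (proj₂ (sound xs)))
  where
  forgets : Forgets σ (λ w → dropAlive (σ w))
  forgets w v = refl
  sound : ∀ xs → Unique (Ends (induced σ xs))
                 × Verdict α φ (Ends (induced σ xs)) (inducedC (λ w → dropAlive (σ w)) xs)
  sound xs = ψ-αφ-sound em α φ (forget-agree forgets xs) (win xs)

-- stillAlive e w: the end output e has not been raised on any proper
-- non-empty prefix of the history w.
stillAlive : ∀ {L : Set} → (List L → Bool) → List L → Bool
stillAlive e [] = true
stillAlive e (x ∷ []) = true
stillAlive e (x ∷ w@(_ ∷ _)) = not (e (x ∷ [])) ∧ stillAlive (λ u → e (x ∷ u)) w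

T-stillAlive-applyUpTo : ∀ {L : Set} (e : List L → Bool) (xs : ℕ → L) i →
  T (stillAlive e (applyUpTo xs (suc i))) ⇔ NoneBefore (λ j → T (e (applyUpTo xs (suc j)))) i
T-stillAlive-applyUpTo e xs zero = mk⇔ (λ _ _ ()) (λ _ → tt)
T-stillAlive-applyUpTo e xs (suc i) with e (xs 0 ∷ []) in e₀
... | true  = mk⇔ (λ ()) (λ none → none 0 (s≤s z≤n) (subst T (sym e₀) tt))
... | false = mk⇔ (λ t → λ { zero _ → subst T e₀ ; (suc j) (s≤s j<i) → to later t j j<i })
                  (λ none → from later (λ j j<i → none (suc j) (s≤s j<i)))
  where
  later : T (stillAlive (λ u → e (xs 0 ∷ u)) (applyUpTo (λ k → xs (suc k)) (suc i)))
          ⇔ NoneBefore (λ j → T (e (applyUpTo xs (suc (suc j))))) i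
  later = T-stillAlive-applyUpTo (λ u → e (xs 0 ∷ u)) (λ k → xs (suc k)) i

T-stillAlive : ∀ {X : Set} (e : List (Letter X) → Bool) (xs : ℕ → Letter X) i →
  T (stillAlive e (prefix xs (suc i))) ⇔ NoneBefore (λ j → T (e (prefix xs (suc j)))) i
T-stillAlive e xs i =
  NoneBefore-cong (λ j → T-cong (cong e (sym (map-upTo xs (suc j))))) i
  ⇔-∘ (T-stillAlive-applyUpTo e xs i
  ⇔-∘ T-cong (cong (stillAlive e) (map-upTo xs (suc i))))

withAlive : ∀ {X Y : Set} → CStrategy X Y → List (Letter X) → Letter (Y ⊎ Fresh)
withAlive σ w (inj₁ y) = σ w (inj₁ y)
withAlive σ w (inj₂ alive) = stillAlive (λ u → σ u (inj₂ end)) w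
withAlive σ w (inj₂ end) = σ w (inj₂ end)

withAlive-winning : ExcludedMiddle 0ℓ →
  ∀ {X Y : Set} (α φ : Form (X ⊎ Y)) (σ : CStrategy X Y) →
  WinningC X Y α φ σ → WinningLTL X (Y ⊎ Fresh) (ψ-αφ α φ) (withAlive σ)
withAlive-winning em α φ σ (unique , verdict) xs =
  ψ-αφ-complete em α φ (forget-agree forgets xs)
    (T-stillAlive (λ u → σ u (inj₂ end)) xs)
    (from (Unique-cong (forget-ends forgets xs)) (unique xs))
    (from (Verdict-cong α φ (forget-ends forgets xs)) (verdict xs))
  where
  forgets : Forgets (withAlive σ) σ
  forgets w (inj₁ y) = refl
  forgets w (inj₂ end) = refl

theorem5 : ExcludedMiddle 0ℓ →
    (X Y : Set) (α φ : Form (X ⊎ Y)) →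
    (RealizableC X Y α φ ⇔ RealizableLTL X (Y ⊎ Fresh) (ψ-αφ α φ))
    × (∀ σ → WinningLTL X (Y ⊎ Fresh) (ψ-αφ α φ) σ →
         WinningC X Y α φ (λ w → dropAlive (σ w)))
theorem5 em X Y α φ =
  mk⇔ (λ (σ , win) → withAlive σ , withAlive-winning em α φ σ win)
      (λ (σ , win) → (λ w → dropAlive (σ w)) , dropAlive-winning em α φ σ win)
  , dropAlive-winning em α φ
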